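{- Let $K_3+e$ denote the paw graph (a triangle together with one extra vertex adjacent to exactly one vertex of the triangle). Then $$D[K_3+e]=W[K_3+e]=W^*[K_3+e]=E[K_3+e]=3.$$
   Context: Graphs are finite, simple, undirected, loopless. First-order sentences about graphs use only adjacency $\sim$ and equality $=$. Write $F\sqsubset G$ if $G$ contains an induced copy of $F$. $D[F]$ (resp. $W[F]$) is the minimum quantifier depth (resp. minimum number of distinct variables) of a first-order sentence $\Phi$ such that for every graph $G$, $G\models\Phi$ iff $F\sqsubset G$. For non-isomorphic graphs $G,H$, $W(G,H)$ is the minimum number of distinct variables of a first-order sentence true on one and false on the other; $W^*[F]=\max\{W(G,H):F\sqsubset G,\ F\not\sqsubset H\}$. For $k\ge2$, $\mathrm{EA}_k$ says: for all disjoint vertex sets $X,Y$ with $|X\cup Y|<k$ there is $z\notin X\cup Y$ adjacent to all of $X$ and to none of $Y$; $\mathrm{EA}_1$ says the graph is non-empty. The extension index $E[F]$ is the minimum $k$ such that every graph satisfying $\mathrm{EA}_k$ contains an induced copy of $F$. -}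

module Defs where

open import Data.Nat using (ℕ; zero; suc; _≤_; _<_; _⊔_; _≡ᵇ_)
open import Data.Nat.Properties using (_≟_)
open import Data.Bool using (Bool; true; false; if_then_else_)
open import Data.Fin using (Fin; zero; suc)
open import Data.Fin.Subset using (Subset; _∈_; _∉_; _∪_; ∣_∣)
open import Data.Maybe using (Maybe; just; nothing)
open import Data.List using (List; []; _∷_; _++_; length; deduplicate)
import Data.List.Membership.Propositional as LM
open import Data.Product using (Σ; ∃; _×_; _,_)
open import Data.Sum using (_⊎_)
open import Data.Empty using (⊥)
open import Data.Unit using (⊤)
open import Relation.Nullary using (¬_)
open import Relation.Binary.PropositionalEquality using (_≡_; refl)
open import Function.Definitions using (Injective)
open import Function.Bundles using (_⇔_)

record Graph : Set where
  field
    n      : ℕ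
    adj    : Fin n → Fin n → Bool
    irrefl : ∀ x → adj x x ≡ false
    sym    : ∀ x y → adj x y ≡ adj y x
open Graph public

_⊏_ : Graph → Graph → Set
F ⊏ G = Σ (Fin (n F) → Fin (n G)) λ f →
          Injective _≡_ _≡_ f × (∀ x y → adj G (f x) (f y) ≡ adj F x y)

data Fm : Set where
  _≐_ : ℕ → ℕ → Fm
  _~_ : ℕ → ℕ → Fm
  ¬'_ : Fm → Fm
  _∧'_ : Fm → Fm → Fm
  _∨'_ : Fm → Fm → Fm
  ∃'  : ℕ → Fm → Fm
  ∀'  : ℕ → Fm → Fm

qd : Fm → ℕ
qd (x ≐ y) = 0
qd (x ~ y) = 0
qd (¬' φ) = qd φ
qd (φ ∧' ψ) = qd φ ⊔ qd ψ
qd (φ ∨' ψ) = qd φ ⊔ qd ψ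
qd (∃' x φ) = suc (qd φ)
qd (∀' x φ) = suc (qd φ)

vars : Fm → List ℕ
vars (x ≐ y) = x ∷ y ∷ []
vars (x ~ y) = x ∷ y ∷ []
vars (¬' φ) = vars φ
vars (φ ∧' ψ) = vars φ ++ vars ψ
vars (φ ∨' ψ) = vars φ ++ vars ψ
vars (∃' x φ) = x ∷ vars φ
vars (∀' x φ) = x ∷ vars φ

nvars : Fm → ℕ
nvars φ = length (deduplicate _≟_ (vars φ))

Scoped : List ℕ → Fm → Set
Scoped b (x ≐ y) = x LM.∈ b × y LM.∈ b
Scoped b (x ~ y) = x LM.∈ b × y LM.∈ b
Scoped b (¬' φ) = Scoped b φ
Scoped b (φ ∧' ψ) = Scoped b φ × Scoped b ψ
Scoped b (φ ∨' ψ) = Scoped b φ × Scoped b ψ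
Scoped b (∃' x φ) = Scoped (x ∷ b) φ
Scoped b (∀' x φ) = Scoped (x ∷ b) φ

Sentence : Fm → Set
Sentence = Scoped []

-- semantics with partial assignments (unassigned variables make atoms false;
-- irrelevant for sentences)
Env : ℕ → Set
Env m = ℕ → Maybe (Fin m)

_[_↦_] : ∀ {m} → Env m → ℕ → Fin m → Env m
(ρ [ x ↦ v ]) y = if y ≡ᵇ x then just v else ρ y

EqM : ∀ {m} → Maybe (Fin m) → Maybe (Fin m) → Set
EqM (just a) (just b) = a ≡ b
EqM _ _ = ⊥

AdjM : (G : Graph) → Maybe (Fin (n G)) → Maybe (Fin (n G)) → Set
AdjM G (just a) (just b) = adj G a b ≡ true
AdjM G _ _ = ⊥

Sat : (G : Graph) → Env (n G) → Fm → Set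
Sat G ρ (x ≐ y) = EqM (ρ x) (ρ y)
Sat G ρ (x ~ y) = AdjM G (ρ x) (ρ y)
Sat G ρ (¬' φ) = ¬ Sat G ρ φ
Sat G ρ (φ ∧' ψ) = Sat G ρ φ × Sat G ρ ψ
Sat G ρ (φ ∨' ψ) = Sat G ρ φ ⊎ Sat G ρ ψ
Sat G ρ (∃' x φ) = Σ (Fin (n G)) λ v → Sat G (ρ [ x ↦ v ]) φ
Sat G ρ (∀' x φ) = (v : Fin (n G)) → Sat G (ρ [ x ↦ v ]) φ

_⊨_ : Graph → Fm → Set
G ⊨ φ = Sat G (λ _ → nothing) φ

Defines : Graph → Fm → Set
Defines F φ = Sentence φ × (∀ G → (G ⊨ φ) ⇔ (F ⊏ G))

Distinguishes : Fm → Graph → Graph → Set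
Distinguishes φ G H = (G ⊨ φ × ¬ (H ⊨ φ)) ⊎ (¬ (G ⊨ φ) × H ⊨ φ)

IsMin : (ℕ → Set) → ℕ → Set
IsMin P m = P m × (∀ j → P j → m ≤ j)

IsMax : (ℕ → Set) → ℕ → Set
IsMax P m = P m × (∀ j → P j → j ≤ m)

D≡ : Graph → ℕ → Set
D≡ F = IsMin (λ d → Σ Fm λ φ → Defines F φ × qd φ ≡ d)

W≡ : Graph → ℕ → Set
W≡ F = IsMin (λ w → Σ Fm λ φ → Defines F φ × nvars φ ≡ w)

W₂≡ : Graph → Graph → ℕ → Set
W₂≡ G H = IsMin (λ w → Σ Fm λ φ → Sentence φ × Distinguishes φ G H × nvars φ ≡ w)

W*≡ : Graph → ℕ → Set
W*≡ F = IsMax (λ w → Σ Graph λ G → Σ Graph λ H →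
                 F ⊏ G × ¬ (F ⊏ H) × W₂≡ G H w)

Disjoint : ∀ {m} → Subset m → Subset m → Set
Disjoint X Y = ∀ v → v ∈ X → v ∉ Y

-- EA k (only meaningful for k ≥ 1; EA 0 is a dummy)
EA : ℕ → Graph → Set
EA zero G = ⊤
EA (suc zero) G = Fin (n G)
EA (suc (suc k)) G =
  (X Y : Subset (n G)) → Disjoint X Y → ∣ X ∪ Y ∣ < suc (suc k) →
  Σ (Fin (n G)) λ z → z ∉ (X ∪ Y) ×
    (∀ x → x ∈ X → adj G z x ≡ true) × (∀ y → y ∈ Y → adj G z y ≡ false)

E≡ : Graph → ℕ → Set
E≡ F = IsMin (λ k → 1 ≤ k × (∀ G → EA k G → F ⊏ G))

-- the paw K₃+e : triangle 0,1,2 plus vertex 3 adjacent only to 0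

pawAdj : Fin 4 → Fin 4 → Bool
pawAdj zero (suc zero) = true
pawAdj zero (suc (suc zero)) = true
pawAdj zero (suc (suc (suc zero))) = true
pawAdj (suc zero) zero = true
pawAdj (suc zero) (suc (suc zero)) = true
pawAdj (suc (suc zero)) zero = true
pawAdj (suc (suc zero)) (suc zero) = true
pawAdj (suc (suc (suc zero))) zero = true
pawAdj _ _ = false

pawIrrefl : ∀ x → pawAdj x x ≡ false
pawIrrefl zero = refl
pawIrrefl (suc zero) = refl
pawIrrefl (suc (suc zero)) = refl
pawIrrefl (suc (suc (suc zero))) = refl

pawSym : ∀ x y → pawAdj x y ≡ pawAdj y x
pawSym zero zero = refl
pawSym zero (suc zero) = refl
pawSym zero (suc (suc zero)) = refl
pawSym zero (suc (suc (suc zero))) = refl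
pawSym (suc zero) zero = refl
pawSym (suc zero) (suc zero) = refl
pawSym (suc zero) (suc (suc zero)) = refl
pawSym (suc zero) (suc (suc (suc zero))) = refl
pawSym (suc (suc zero)) zero = refl
pawSym (suc (suc zero)) (suc zero) = refl
pawSym (suc (suc zero)) (suc (suc zero)) = refl
pawSym (suc (suc zero)) (suc (suc (suc zero))) = refl
pawSym (suc (suc (suc zero))) zero = refl
pawSym (suc (suc (suc zero))) (suc zero) = refl
pawSym (suc (suc (suc zero))) (suc (suc zero)) = refl
pawSym (suc (suc (suc zero))) (suc (suc (suc zero))) = refl

paw : Graph
paw = record { n = 4 ; adj = pawAdj ; irrefl = pawIrrefl ; sym = pawSym }

-- All upper bounds come from one sentence of depth 3 in 3 variables: some vertex x lies on
-- a triangle and has a non-neighbour y such that one neighbour of x is adjacent to y and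
-- another is not.  A short case analysis finds a paw in any such configuration, and EA₃
-- produces the configuration directly.
--
-- For the lower bounds call a graph 2-extendable if it is non-empty and every vertex has a
-- neighbour and a non-neighbour other than itself (this is EA₂).  Between two 2-extendable
-- graphs Duplicator wins the 2-pebble game: whatever type (equal, adjacent, non-adjacent) the
-- new pebble has with the single other pebble can be matched.  So no sentence with two
-- variables, or of depth two, separates them.  The tadpole (a triangle with a pendant path of
-- length two) contains the paw, C₅ does not, and both are 2-extendable; C₅ satisfying EA₂
-- also gives E ≥ 3.

module Submission where

open import Defs renaming (sym to adj-sym)
open import Data.Bool using (Bool; true; false; not; if_then_else_; _∧_; _∨_; T)
open import Data.Bool.Properties using (¬-not; ∨-comm) renaming (_≟_ to _≟ᵇ_)
open import Data.Fin using (Fin; zero; suc; #_; inject₁)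
open import Data.Fin.Properties using (all?; any?; inject₁-injective) renaming (_≟_ to _≟ᶠ_)
open import Data.Fin.Subset using (Subset; ⁅_⁆; _∪_; ∣_∣; Nonempty)
  renaming (_∈_ to _∈ₛ_; _∉_ to _∉ₛ_; ⊥ to ∅)
open import Data.Fin.Subset.Properties
  using (∉⊥; ∣⊥∣≡0; ∣⁅x⁆∣≡1; x∈⁅x⁆; x∈⁅y⁆⇒x≡y; x∈p∪q⁺; x∈p∪q⁻; ∣p∣≤∣x∷p∣; nonempty?;
         x∈p∧x≢y⇒x∈p-y; x∈p⇒∣p-x∣<∣p∣)
open import Data.List using (List; []; _∷_; length; deduplicate)
open import Data.Bool.ListAction using (any)
open import Data.List.Membership.Propositional using (_∈_; _∉_)
open import Data.List.Membership.Propositional.Properties using (∈-++⁺ˡ; ∈-++⁺ʳ; ∈-deduplicate⁺)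
open import Data.List.Relation.Binary.Subset.Propositional using (_⊆_)
open import Data.List.Relation.Unary.Any using (here; there)
open import Data.Vec using ([]; _∷_)
open import Data.Maybe using (Maybe; just; nothing)
open import Data.Nat using (ℕ; zero; suc; _+_; _≤_; _≡ᵇ_; z≤n; s≤s; s≤s⁻¹)
open import Data.Nat.Properties
  using (_≟_; ≤-trans; ≤-reflexive; ≰⇒>; +-suc; +-mono-≤; +-monoʳ-≤; m≤m⊔n; m≤n⊔m;
         m+n≤o⇒m≤o; ≡ᵇ⇒≡; ≡⇒≡ᵇ)
open import Data.List.Membership.DecPropositional _≟_ using (_∈?_)
open import Data.Product using (Σ; ∃-syntax; _×_; _,_; proj₁; proj₂; swap)
open import Data.Product.Function.NonDependent.Propositional using (_×-⇔_)
open import Data.Sum using (_⊎_; inj₁; inj₂)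
open import Data.Sum.Function.Propositional using (_⊎-⇔_)
open import Data.Unit using (⊤; tt)
open import Function using (_∘_)
open import Function.Bundles using (_⇔_; mk⇔; Equivalence)
open import Function.Construct.Composition using (_⇔-∘_)
open import Function.Construct.Symmetry using (⇔-sym)
open import Function.Definitions using (Injective)
open import Function.Related.TypeIsomorphisms using (¬-cong-⇔)
open import Relation.Binary.PropositionalEquality
  using (_≡_; _≢_; refl; sym; trans; cong; cong₂; subst; ≢-sym; module ≡-Reasoning)
open import Relation.Nullary using (¬_; Dec; yes; no; does; contradiction)
open import Relation.Nullary.Decidable
  using (toWitness; map′; ¬?; _×-dec_; _→-dec_; dec-true; dec-false)

open Equivalence using (to; from)

~-flip : ∀ (G : Graph) {u v b} → adj G u v ≡ b → adj G v u ≡ b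
~-flip G {u} {v} eq = trans (adj-sym G v u) eq

adj⇒≢ : ∀ (G : Graph) {u v} → adj G u v ≡ true → u ≢ v
adj⇒≢ G {u} u~u refl = contradiction (trans (sym u~u) (irrefl G u)) λ ()

module _ {m : ℕ} (edges : List (Fin m × Fin m)) where

  private
    listed : Fin m → Fin m → Bool
    listed x y = any (λ (a , b) → does (a ≟ᶠ x) ∧ does (b ≟ᶠ y)) edges

    does-≟-sym : (x y : Fin m) → does (x ≟ᶠ y) ≡ does (y ≟ᶠ x)
    does-≟-sym x y with x ≟ᶠ y
    ... | yes x≡y = sym (dec-true (y ≟ᶠ x) (sym x≡y))
    ... | no x≢y = sym (dec-false (y ≟ᶠ x) (≢-sym x≢y))

  edgeAdj : Fin m → Fin m → Bool
  edgeAdj x y = not (does (x ≟ᶠ y)) ∧ (listed x y ∨ listed y x)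

  edgeAdj-irrefl : ∀ x → edgeAdj x x ≡ false
  edgeAdj-irrefl x rewrite dec-true (x ≟ᶠ x) refl = refl

  edgeAdj-sym : ∀ x y → edgeAdj x y ≡ edgeAdj y x
  edgeAdj-sym x y = cong₂ _∧_ (cong not (does-≟-sym x y)) (∨-comm (listed x y) (listed y x))

fromEdges : (m : ℕ) → List (Fin m × Fin m) → Graph
fromEdges m edges = record
  { n = m ; adj = edgeAdj edges ; irrefl = edgeAdj-irrefl edges ; sym = edgeAdj-sym edges }

C₅ : Graph
C₅ = fromEdges 5 ((# 0 , # 1) ∷ (# 1 , # 2) ∷ (# 2 , # 3) ∷ (# 3 , # 4) ∷ (# 4 , # 0) ∷ [])

tadpole : Graph
tadpole = fromEdges 5 ((# 0 , # 1) ∷ (# 1 , # 2) ∷ (# 2 , # 0) ∷ (# 0 , # 3) ∷ (# 3 , # 4) ∷ [])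

-- Induced copies of the paw

PointDetermining : Graph → Set
PointDetermining F = ∀ i j → (∀ k → adj F k i ≡ adj F k j) → i ≡ j

paw-pointDetermining : PointDetermining paw
paw-pointDetermining = toWitness {a? = all? λ i → all? λ j →
  (all? λ k → pawAdj k i ≟ᵇ pawAdj k j) →-dec (i ≟ᶠ j)} tt

preserving⇒injective : ∀ {F G} → PointDetermining F → {f : Fin (n F) → Fin (n G)} →
  (∀ x y → adj G (f x) (f y) ≡ adj F x y) → Injective _≡_ _≡_ f
preserving⇒injective {F} {G} determined {f} preserves {i} {j} fi≡fj = determined i j λ k → begin
  adj F k i         ≡⟨ sym (preserves k i) ⟩
  adj G (f k) (f i) ≡⟨ cong (adj G (f k)) fi≡fj ⟩
  adj G (f k) (f j) ≡⟨ preserves k j ⟩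
  adj F k j         ∎
  where open ≡-Reasoning

paw⊏⁺ : (G : Graph) (q₀ q₁ q₂ q₃ : Fin (n G)) →
  adj G q₀ q₁ ≡ true → adj G q₀ q₂ ≡ true → adj G q₀ q₃ ≡ true →
  adj G q₁ q₂ ≡ true → adj G q₁ q₃ ≡ false → adj G q₂ q₃ ≡ false → paw ⊏ G
paw⊏⁺ G q₀ q₁ q₂ q₃ e₀₁ e₀₂ e₀₃ e₁₂ e₁₃ e₂₃ =
  f , preserving⇒injective {paw} {G} paw-pointDetermining preserves , preserves
  where
  f : Fin 4 → Fin (n G)
  f zero = q₀
  f (suc zero) = q₁
  f (suc (suc zero)) = q₂
  f (suc (suc (suc zero))) = q₃
  preserves : ∀ x y → adj G (f x) (f y) ≡ pawAdj x y
  preserves zero zero = irrefl G q₀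
  preserves zero (suc zero) = e₀₁
  preserves zero (suc (suc zero)) = e₀₂
  preserves zero (suc (suc (suc zero))) = e₀₃
  preserves (suc zero) zero = ~-flip G e₀₁
  preserves (suc zero) (suc zero) = irrefl G q₁
  preserves (suc zero) (suc (suc zero)) = e₁₂
  preserves (suc zero) (suc (suc (suc zero))) = e₁₃
  preserves (suc (suc zero)) zero = ~-flip G e₀₂
  preserves (suc (suc zero)) (suc zero) = ~-flip G e₁₂
  preserves (suc (suc zero)) (suc (suc zero)) = irrefl G q₂
  preserves (suc (suc zero)) (suc (suc (suc zero))) = e₂₃
  preserves (suc (suc (suc zero))) zero = ~-flip G e₀₃
  preserves (suc (suc (suc zero))) (suc zero) = ~-flip G e₁₃
  preserves (suc (suc (suc zero))) (suc (suc zero)) = ~-flip G e₂₃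
  preserves (suc (suc (suc zero))) (suc (suc (suc zero))) = irrefl G q₃

TriangleFree : Graph → Set
TriangleFree G = ∀ a b c → ¬ (adj G a b ≡ true × adj G b c ≡ true × adj G a c ≡ true)

triangleFree⇒paw⊄ : ∀ {G} → TriangleFree G → ¬ paw ⊏ G
triangleFree⇒paw⊄ triangleFree (f , _ , preserves) =
  triangleFree (f (# 0)) (f (# 1)) (f (# 2))
    (preserves (# 0) (# 1) , preserves (# 1) (# 2) , preserves (# 0) (# 2))

C₅-triangleFree : TriangleFree C₅
C₅-triangleFree = toWitness {a? = all? λ a → all? λ b → all? λ c →
  ¬? ((adj C₅ a b ≟ᵇ true) ×-dec (adj C₅ b c ≟ᵇ true) ×-dec (adj C₅ a c ≟ᵇ true))} tt

paw⊄C₅ : ¬ paw ⊏ C₅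
paw⊄C₅ = triangleFree⇒paw⊄ {C₅} C₅-triangleFree

paw⊏tadpole : paw ⊏ tadpole
paw⊏tadpole = inject₁ , inject₁-injective , toWitness {a? = all? λ x → all? λ y →
  adj tadpole (inject₁ x) (inject₁ y) ≟ᵇ pawAdj x y} tt

-- The defining sentence

record PawPattern (G : Graph) : Set where
  field
    x a b y c p : Fin (n G)
    a~x : adj G a x ≡ true
    b~x : adj G b x ≡ true
    b~a : adj G b a ≡ true
    y≁x : adj G y x ≡ false
    c~x : adj G c x ≡ true
    c~y : adj G c y ≡ true
    p~x : adj G p x ≡ true
    p≁y : adj G p y ≡ false

module _ {G : Graph} (P : PawPattern G) where
  open PawPattern P

  private
    flip~ : ∀ {u v b} → adj G u v ≡ b → adj G v u ≡ b
    flip~ = ~-flip G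

  PawPattern⇒paw⊏ : paw ⊏ G
  PawPattern⇒paw⊏ with adj G a y in a~y
  ... | true with adj G a p in a~p
  ...   | true = paw⊏⁺ G a x p y a~x a~p a~y (flip~ p~x) (flip~ y≁x) p≁y
  ...   | false with adj G b y in b~y
  ...     | false = paw⊏⁺ G a x b y a~x (flip~ b~a) a~y (flip~ b~x) (flip~ y≁x) b~y
  ...     | true with adj G b p in b~p
  ...       | true = paw⊏⁺ G b x p y b~x b~p b~y (flip~ p~x) (flip~ y≁x) p≁y
  ...       | false = paw⊏⁺ G x a b p (flip~ a~x) (flip~ b~x) (flip~ p~x) (flip~ b~a) a~p b~p
  PawPattern⇒paw⊏ | false with adj G a c in a~c
  ... | true = paw⊏⁺ G c x a y c~x (flip~ a~c) c~y (flip~ a~x) (flip~ y≁x) a~y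
  ... | false with adj G b y in b~y
  ...   | true = paw⊏⁺ G b x a y b~x b~a b~y (flip~ a~x) (flip~ y≁x) a~y
  ...   | false with adj G b c in b~c
  ...     | true = paw⊏⁺ G c x b y c~x (flip~ b~c) c~y (flip~ b~x) (flip~ y≁x) b~y
  ...     | false = paw⊏⁺ G x a b c (flip~ a~x) (flip~ b~x) (flip~ c~x) (flip~ b~a) a~c b~c

pawSentence : Fm
pawSentence =
  ∃' x (∃' y (∃' z ((y ~ x) ∧' ((z ~ x) ∧' (z ~ y))))
        ∧' ∃' y ((¬' (y ~ x)) ∧' (∃' z ((z ~ x) ∧' (z ~ y)) ∧' ∃' z ((z ~ x) ∧' (¬' (z ~ y))))))
  where
  x y z : ℕ
  x = 0
  y = 1
  z = 2

scoped? : ∀ bound φ → Dec (Scoped bound φ)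
scoped? bound (x ≐ y) = (x ∈? bound) ×-dec (y ∈? bound)
scoped? bound (x ~ y) = (x ∈? bound) ×-dec (y ∈? bound)
scoped? bound (¬' φ) = scoped? bound φ
scoped? bound (φ ∧' ψ) = scoped? bound φ ×-dec scoped? bound ψ
scoped? bound (φ ∨' ψ) = scoped? bound φ ×-dec scoped? bound ψ
scoped? bound (∃' x φ) = scoped? (x ∷ bound) φ
scoped? bound (∀' x φ) = scoped? (x ∷ bound) φ

pawSentence-closed : Sentence pawSentence
pawSentence-closed = toWitness {a? = scoped? [] pawSentence} tt

⊨pawSentence⇒PawPattern : ∀ {G} → G ⊨ pawSentence → PawPattern G
⊨pawSentence⇒PawPattern
  (x , (a , b , a~x , b~x , b~a) , (y , y≁x , (c , c~x , c~y) , (p , p~x , p≁y))) =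
  record { x = x ; a = a ; b = b ; y = y ; c = c ; p = p
         ; a~x = a~x ; b~x = b~x ; b~a = b~a ; y≁x = ¬-not y≁x
         ; c~x = c~x ; c~y = c~y ; p~x = p~x ; p≁y = ¬-not p≁y }

paw⊏⇒⊨pawSentence : ∀ {G} → paw ⊏ G → G ⊨ pawSentence
paw⊏⇒⊨pawSentence {G} (f , _ , preserves) =
  f (# 1) ,
  (f (# 0) , f (# 2) , preserves (# 0) (# 1) , preserves (# 2) (# 1) , preserves (# 2) (# 0)) ,
  (f (# 3) , not-true (preserves (# 3) (# 1)) ,
   (f (# 0) , preserves (# 0) (# 1) , preserves (# 0) (# 3)) ,
   (f (# 2) , preserves (# 2) (# 1) , not-true (preserves (# 2) (# 3))))
  where
  not-true : ∀ {b} → b ≡ false → b ≢ true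
  not-true refl ()

pawSentence-defines : Defines paw pawSentence
pawSentence-defines = pawSentence-closed , λ G →
  mk⇔ (PawPattern⇒paw⊏ ∘ ⊨pawSentence⇒PawPattern {G}) (paw⊏⇒⊨pawSentence {G})

-- Two-pebble games on 2-extendable graphs

record TwoExtendable (G : Graph) : Set where
  field
    vertex       : Fin (n G)
    neighbour    : ∀ v → ∃[ u ] adj G u v ≡ true
    nonNeighbour : ∀ v → ∃[ u ] u ≢ v × adj G u v ≡ false

twoExtendable? : ∀ G → Dec (TwoExtendable G)
twoExtendable? G =
  map′ (λ ((v , _) , nb , nn) → record { vertex = v ; neighbour = nb ; nonNeighbour = nn })
       (λ e → let open TwoExtendable e in (vertex , tt) , neighbour , nonNeighbour)
       (any? (λ _ → yes tt) ×-dec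
        (all? λ v → any? λ u → adj G u v ≟ᵇ true) ×-dec
        (all? λ v → any? λ u → ¬? (u ≟ᶠ v) ×-dec (adj G u v ≟ᵇ false)))

tadpole-twoExtendable : TwoExtendable tadpole
tadpole-twoExtendable = toWitness {a? = twoExtendable? tadpole} tt

C₅-twoExtendable : TwoExtendable C₅
C₅-twoExtendable = toWitness {a? = twoExtendable? C₅} tt

data AtomType : Set where
  unset same edge nonEdge : AtomType

vertexType : (G : Graph) → Fin (n G) → Fin (n G) → AtomType
vertexType G u v = if does (u ≟ᶠ v) then same else (if adj G u v then edge else nonEdge)

atomType : (G : Graph) → Maybe (Fin (n G)) → Maybe (Fin (n G)) → AtomType
atomType G (just u) (just v) = vertexType G u v
atomType G _ _ = unset

module _ (G : Graph) where

  vertexType-refl : ∀ v → vertexType G v v ≡ same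
  vertexType-refl v rewrite dec-true (v ≟ᶠ v) refl = refl

  vertexType-≢unset : ∀ u v → vertexType G u v ≢ unset
  vertexType-≢unset u v with does (u ≟ᶠ v) | adj G u v
  ... | true  | _     = λ ()
  ... | false | true  = λ ()
  ... | false | false = λ ()

  vertexType-sym : ∀ u v → vertexType G u v ≡ vertexType G v u
  vertexType-sym u v with u ≟ᶠ v | v ≟ᶠ u
  ... | yes _   | yes _   = refl
  ... | yes u≡v | no v≢u  = contradiction (sym u≡v) v≢u
  ... | no u≢v  | yes v≡u = contradiction (sym v≡u) u≢v
  ... | no _    | no _    rewrite adj-sym G u v = refl

  vertexType-edge : ∀ {u v} → adj G u v ≡ true → vertexType G u v ≡ edge
  vertexType-edge {u} {v} u~v rewrite dec-false (u ≟ᶠ v) (adj⇒≢ G u~v) | u~v = refl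

  vertexType-nonEdge : ∀ {u v} → u ≢ v → adj G u v ≡ false → vertexType G u v ≡ nonEdge
  vertexType-nonEdge {u} {v} u≢v u≁v rewrite dec-false (u ≟ᶠ v) u≢v | u≁v = refl

  atomType-sym : ∀ m m' → atomType G m m' ≡ atomType G m' m
  atomType-sym (just u) (just v) = vertexType-sym u v
  atomType-sym (just _) nothing  = refl
  atomType-sym nothing  (just _) = refl
  atomType-sym nothing  nothing  = refl

  EqM⇔same : ∀ m m' → EqM m m' ⇔ (atomType G m m' ≡ same)
  EqM⇔same (just u) (just v) = mk⇔ (λ { refl → vertexType-refl u }) (same⇒≡ u v)
    where
    same⇒≡ : ∀ u v → vertexType G u v ≡ same → u ≡ v
    same⇒≡ u v with u ≟ᶠ v | adj G u v
    ... | yes u≡v | _     = λ _ → u≡v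
    ... | no _    | true  = λ ()
    ... | no _    | false = λ ()
  EqM⇔same (just _) nothing = mk⇔ (λ ()) (λ ())
  EqM⇔same nothing  _       = mk⇔ (λ ()) (λ ())

  AdjM⇔edge : ∀ m m' → AdjM G m m' ⇔ (atomType G m m' ≡ edge)
  AdjM⇔edge (just u) (just v) = mk⇔ vertexType-edge (edge⇒adj u v)
    where
    edge⇒adj : ∀ u v → vertexType G u v ≡ edge → adj G u v ≡ true
    edge⇒adj u v with does (u ≟ᶠ v) | adj G u v
    ... | true  | _     = λ ()
    ... | false | true  = λ _ → refl
    ... | false | false = λ ()
  AdjM⇔edge (just _) nothing = mk⇔ (λ ()) (λ ())
  AdjM⇔edge nothing  _       = mk⇔ (λ ()) (λ ())

∉-pair : ∀ {x c z : ℕ} → x ≢ c → x ≢ z → x ∉ c ∷ z ∷ []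
∉-pair x≢c _   (here x≡c)         = x≢c x≡c
∉-pair _   x≢z (there (here x≡z)) = x≢z x≡z

UndefinedOutside : ∀ {m m'} → List ℕ → Env m → Env m' → Set
UndefinedOutside L ρ σ = ∀ {x} → x ∉ L → ρ x ≡ nothing × σ x ≡ nothing

≡ᵇ-false⇒≢ : ∀ {x z} → (x ≡ᵇ z) ≡ false → x ≢ z
≡ᵇ-false⇒≢ {x} {z} x≢ᵇz x≡z = subst T x≢ᵇz (≡⇒≡ᵇ x z x≡z)

update-≢ : ∀ {m} (ρ : Env m) {z} v {x} → x ≢ z → (ρ [ z ↦ v ]) x ≡ ρ x
update-≢ ρ {z} v {x} x≢z with x ≡ᵇ z in x≡ᵇz
... | true  = contradiction (≡ᵇ⇒≡ x z (subst T (sym x≡ᵇz) tt)) x≢z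
... | false = refl

UndefinedOutside-update : ∀ {m m'} {L} {ρ : Env m} {σ : Env m'} {z} v v' →
  UndefinedOutside L ρ σ → UndefinedOutside (z ∷ L) (ρ [ z ↦ v ]) (σ [ z ↦ v' ])
UndefinedOutside-update {ρ = ρ} {σ} v v' undefined x∉z∷L =
  trans (update-≢ ρ v x≢z) (proj₁ (undefined (x∉z∷L ∘ there))) ,
  trans (update-≢ σ v' x≢z) (proj₂ (undefined (x∉z∷L ∘ there)))
  where x≢z = x∉z∷L ∘ here

record PartialIso (G H : Graph) (ρ : Env (n G)) (σ : Env (n H)) : Set where
  constructor mkPartialIso
  field typesAgree : ∀ x y → atomType G (ρ x) (ρ y) ≡ atomType H (σ x) (σ y)
open PartialIso

module _ {G H : Graph} where

  PartialIso-sym : ∀ {ρ σ} → PartialIso G H ρ σ → PartialIso H G σ ρ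
  PartialIso-sym iso = mkPartialIso λ x y → sym (typesAgree iso x y)

  PartialIso-update : ∀ {ρ σ z v v'} → PartialIso G H ρ σ →
    (∀ y → y ≢ z → atomType G (just v) (ρ y) ≡ atomType H (just v') (σ y)) →
    PartialIso G H (ρ [ z ↦ v ]) (σ [ z ↦ v' ])
  PartialIso-update {ρ} {σ} {z} {v} {v'} iso agree = mkPartialIso agree′
    where
    agree′ : ∀ x y → atomType G ((ρ [ z ↦ v ]) x) ((ρ [ z ↦ v ]) y)
                   ≡ atomType H ((σ [ z ↦ v' ]) x) ((σ [ z ↦ v' ]) y)
    agree′ x y with x ≡ᵇ z in x≡ᵇz | y ≡ᵇ z in y≡ᵇz
    ... | true  | true  = trans (vertexType-refl G v) (sym (vertexType-refl H v'))
    ... | true  | false = agree y (≡ᵇ-false⇒≢ y≡ᵇz)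
    ... | false | true  = begin
      atomType G (ρ x) (just v)  ≡⟨ atomType-sym G (ρ x) _ ⟩
      atomType G (just v) (ρ x)  ≡⟨ agree x (≡ᵇ-false⇒≢ x≡ᵇz) ⟩
      atomType H (just v') (σ x) ≡⟨ atomType-sym H _ (σ x) ⟩
      atomType H (σ x) (just v') ∎
      where open ≡-Reasoning
    ... | false | false = typesAgree iso x y

module _ {H : Graph} (extendable : TwoExtendable H) where
  open TwoExtendable extendable

  realise : ∀ t → t ≢ unset → ∀ u' → ∃[ v' ] vertexType H v' u' ≡ t
  realise unset   t≢unset _  = contradiction refl t≢unset
  realise same    _       u' = u' , vertexType-refl H u'
  realise edge    _       u' = let v' , v'~u' = neighbour u' in v' , vertexType-edge H v'~u'
  realise nonEdge _       u' =
    let v' , v'≢u' , v'≁u' = nonNeighbour u' in v' , vertexType-nonEdge H v'≢u' v'≁u'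

  module _ {G : Graph} {ρ : Env (n G)} {σ : Env (n H)} (iso : PartialIso G H ρ σ) where

    respond : ∀ c v → ∃[ v' ] atomType G (just v) (ρ c) ≡ atomType H (just v') (σ c)
    respond c v with ρ c | σ c | typesAgree iso c c
    ... | nothing | nothing | _  = vertex , refl
    ... | just u  | just u' | _  =
      let v' , v'u'≡vu = realise (vertexType G v u) (vertexType-≢unset G v u) u' in v' , sym v'u'≡vu
    ... | just u  | nothing | uu = contradiction uu (vertexType-≢unset G u u)
    ... | nothing | just u' | uu = contradiction (sym uu) (vertexType-≢unset H u' u')

    extend : ∀ {c z} → UndefinedOutside (c ∷ z ∷ []) ρ σ →
      ∀ v → ∃[ v' ] PartialIso G H (ρ [ z ↦ v ]) (σ [ z ↦ v' ])
    extend {c} {z} undefined v = v' , PartialIso-update iso agree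
      where
      v' = proj₁ (respond c v)
      agree : ∀ y → y ≢ z → atomType G (just v) (ρ y) ≡ atomType H (just v') (σ y)
      agree y y≢z with y ≟ c
      ... | yes refl = proj₂ (respond c v)
      ... | no y≢c with undefined (∉-pair y≢c y≢z)
      ...   | ρy≡nothing , σy≡nothing rewrite ρy≡nothing | σy≡nothing = refl

-- L bounds the variables that may be bound when a subformula is reached; each quantifier may
-- keep the value of at most one of them, c, besides its own variable.
TwoPebble : List ℕ → Fm → Set
TwoPebble L (x ≐ y) = ⊤
TwoPebble L (x ~ y) = ⊤
TwoPebble L (¬' φ) = TwoPebble L φ
TwoPebble L (φ ∧' ψ) = TwoPebble L φ × TwoPebble L ψ
TwoPebble L (φ ∨' ψ) = TwoPebble L φ × TwoPebble L ψ
TwoPebble L (∃' z φ) = (∃[ c ] L ⊆ c ∷ z ∷ []) × TwoPebble (z ∷ L) φ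
TwoPebble L (∀' z φ) = (∃[ c ] L ⊆ c ∷ z ∷ []) × TwoPebble (z ∷ L) φ

backAndForth-∃ : ∀ {A B : Set} {P : A → Set} {Q : B → Set} →
  (∀ a → ∃[ b ] P a ⇔ Q b) → (∀ b → ∃[ a ] P a ⇔ Q b) → (∃[ a ] P a) ⇔ (∃[ b ] Q b)
backAndForth-∃ forth back = mk⇔
  (λ (a , Pa) → let b , P⇔Q = forth a in b , to P⇔Q Pa)
  (λ (b , Qb) → let a , P⇔Q = back b in a , from P⇔Q Qb)

backAndForth-∀ : ∀ {A B : Set} {P : A → Set} {Q : B → Set} →
  (∀ a → ∃[ b ] P a ⇔ Q b) → (∀ b → ∃[ a ] P a ⇔ Q b) → (∀ a → P a) ⇔ (∀ b → Q b)
backAndForth-∀ forth back = mk⇔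
  (λ ∀P b → let a , P⇔Q = back b in to P⇔Q (∀P a))
  (λ ∀Q a → let b , P⇔Q = forth a in from P⇔Q (∀Q b))

⇔-viaType : ∀ {A B : Set} {t t' s : AtomType} → A ⇔ (t ≡ s) → B ⇔ (t' ≡ s) → t ≡ t' → A ⇔ B
⇔-viaType A⇔ B⇔ refl = ⇔-sym B⇔ ⇔-∘ A⇔

module _ {G H : Graph} (extendableG : TwoExtendable G) (extendableH : TwoExtendable H) where

  transfer : ∀ {L} φ {ρ σ} → TwoPebble L φ → PartialIso G H ρ σ → UndefinedOutside L ρ σ →
    Sat G ρ φ ⇔ Sat H σ φ

  forth : ∀ {L} z φ {ρ σ} → ∃[ c ] L ⊆ c ∷ z ∷ [] → TwoPebble (z ∷ L) φ →
    PartialIso G H ρ σ → UndefinedOutside L ρ σ →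
    ∀ v → ∃[ v' ] Sat G (ρ [ z ↦ v ]) φ ⇔ Sat H (σ [ z ↦ v' ]) φ

  back : ∀ {L} z φ {ρ σ} → ∃[ c ] L ⊆ c ∷ z ∷ [] → TwoPebble (z ∷ L) φ →
    PartialIso G H ρ σ → UndefinedOutside L ρ σ →
    ∀ v' → ∃[ v ] Sat G (ρ [ z ↦ v ]) φ ⇔ Sat H (σ [ z ↦ v' ]) φ

  transfer (x ≐ y) {ρ} {σ} _ iso _ =
    ⇔-viaType (EqM⇔same G (ρ x) (ρ y)) (EqM⇔same H (σ x) (σ y)) (typesAgree iso x y)
  transfer (x ~ y) {ρ} {σ} _ iso _ =
    ⇔-viaType (AdjM⇔edge G (ρ x) (ρ y)) (AdjM⇔edge H (σ x) (σ y)) (typesAgree iso x y)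
  transfer (¬' φ) pebble iso undefined = ¬-cong-⇔ (transfer φ pebble iso undefined)
  transfer (φ ∧' ψ) (pφ , pψ) iso undefined =
    transfer φ pφ iso undefined ×-⇔ transfer ψ pψ iso undefined
  transfer (φ ∨' ψ) (pφ , pψ) iso undefined =
    transfer φ pφ iso undefined ⊎-⇔ transfer ψ pψ iso undefined
  transfer (∃' z φ) (cover , pφ) iso undefined =
    backAndForth-∃ (forth z φ cover pφ iso undefined) (back z φ cover pφ iso undefined)
  transfer (∀' z φ) (cover , pφ) iso undefined =
    backAndForth-∀ (forth z φ cover pφ iso undefined) (back z φ cover pφ iso undefined)

  forth z φ (c , L⊆) pφ iso undefined v =
    let v' , iso' = extend extendableH iso (undefined ∘ (_∘ L⊆)) v
    in v' , transfer φ pφ iso' (UndefinedOutside-update v v' undefined)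

  back z φ (c , L⊆) pφ iso undefined v' =
    let v , iso' = extend extendableG (PartialIso-sym iso) (swap ∘ undefined ∘ (_∘ L⊆)) v'
    in v , transfer φ pφ (PartialIso-sym iso') (UndefinedOutside-update v v' undefined)

twoPebble-⊨-⇔ : ∀ {G H} φ → TwoExtendable G → TwoExtendable H → TwoPebble [] φ → (G ⊨ φ) ⇔ (H ⊨ φ)
twoPebble-⊨-⇔ φ extendableG extendableH pebble =
  transfer extendableG extendableH φ pebble (mkPartialIso λ _ _ → refl) (λ _ → refl , refl)

twoPebble-indistinguishable : ∀ {G H} φ → TwoExtendable G → TwoExtendable H →
  Distinguishes φ G H → ¬ TwoPebble [] φ
twoPebble-indistinguishable φ extendableG extendableH (inj₁ (G⊨φ , H⊭φ)) pebble =
  H⊭φ (to (twoPebble-⊨-⇔ φ extendableG extendableH pebble) G⊨φ)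
twoPebble-indistinguishable φ extendableG extendableH (inj₂ (G⊭φ , H⊨φ)) pebble =
  G⊭φ (from (twoPebble-⊨-⇔ φ extendableG extendableH pebble) H⊨φ)

defines⇒distinguishes : ∀ F φ → Defines F φ → ∀ G H → F ⊏ G → ¬ F ⊏ H → Distinguishes φ G H
defines⇒distinguishes F φ (_ , defines) G H F⊏G F⊄H =
  inj₁ (from (defines G) F⊏G , F⊄H ∘ to (defines H))

cover-by-two : ∀ {z : ℕ} {D} → z ∈ D → length D ≤ 2 → ∃[ c ] D ⊆ c ∷ z ∷ []
cover-by-two {D = d ∷ []} (here refl) _ = d , λ { (here refl) → here refl }
cover-by-two {D = d ∷ e ∷ []} (here refl) _ =
  e , λ { (here refl) → there (here refl) ; (there (here refl)) → here refl }
cover-by-two {D = d ∷ e ∷ []} (there (here refl)) _ =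
  d , λ { (here refl) → here refl ; (there (here refl)) → there (here refl) }
cover-by-two {D = _ ∷ _ ∷ _ ∷ _} _ (s≤s (s≤s ()))

qd-twoPebble : ∀ φ {L} → length L + qd φ ≤ 2 → TwoPebble L φ

qd-quantifier : ∀ z φ {L} → length L + suc (qd φ) ≤ 2 →
  (∃[ c ] L ⊆ c ∷ z ∷ []) × TwoPebble (z ∷ L) φ

qd-twoPebble (x ≐ y) _ = tt
qd-twoPebble (x ~ y) _ = tt
qd-twoPebble (¬' φ) bound = qd-twoPebble φ bound
qd-twoPebble (φ ∧' ψ) {L} bound =
  qd-twoPebble φ (≤-trans (+-monoʳ-≤ (length L) (m≤m⊔n (qd φ) (qd ψ))) bound) ,
  qd-twoPebble ψ (≤-trans (+-monoʳ-≤ (length L) (m≤n⊔m (qd φ) (qd ψ))) bound)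
qd-twoPebble (φ ∨' ψ) {L} bound =
  qd-twoPebble φ (≤-trans (+-monoʳ-≤ (length L) (m≤m⊔n (qd φ) (qd ψ))) bound) ,
  qd-twoPebble ψ (≤-trans (+-monoʳ-≤ (length L) (m≤n⊔m (qd φ) (qd ψ))) bound)
qd-twoPebble (∃' z φ) bound = qd-quantifier z φ bound
qd-twoPebble (∀' z φ) bound = qd-quantifier z φ bound

qd-quantifier z φ {L} bound =
  let c , z∷L⊆ = cover-by-two {D = z ∷ L} (here refl) (m+n≤o⇒m≤o (length (z ∷ L)) bound′)
  in (c , z∷L⊆ ∘ there) , qd-twoPebble φ bound′
  where
  bound′ : length (z ∷ L) + qd φ ≤ 2
  bound′ = subst (_≤ 2) (+-suc (length L) (qd φ)) bound

vars-twoPebble : ∀ φ {D L} → length D ≤ 2 → vars φ ⊆ D → L ⊆ D → TwoPebble L φ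

vars-quantifier : ∀ z φ {D L} → length D ≤ 2 → z ∷ vars φ ⊆ D → L ⊆ D →
  (∃[ c ] L ⊆ c ∷ z ∷ []) × TwoPebble (z ∷ L) φ

vars-twoPebble (x ≐ y) _ _ _ = tt
vars-twoPebble (x ~ y) _ _ _ = tt
vars-twoPebble (¬' φ) small varsφ⊆ L⊆ = vars-twoPebble φ small varsφ⊆ L⊆
vars-twoPebble (φ ∧' ψ) small vars⊆ L⊆ =
  vars-twoPebble φ small (vars⊆ ∘ ∈-++⁺ˡ) L⊆ , vars-twoPebble ψ small (vars⊆ ∘ ∈-++⁺ʳ (vars φ)) L⊆
vars-twoPebble (φ ∨' ψ) small vars⊆ L⊆ =
  vars-twoPebble φ small (vars⊆ ∘ ∈-++⁺ˡ) L⊆ , vars-twoPebble ψ small (vars⊆ ∘ ∈-++⁺ʳ (vars φ)) L⊆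
vars-twoPebble (∃' z φ) small vars⊆ L⊆ = vars-quantifier z φ small vars⊆ L⊆
vars-twoPebble (∀' z φ) small vars⊆ L⊆ = vars-quantifier z φ small vars⊆ L⊆

vars-quantifier z φ small vars⊆ L⊆ =
  let c , D⊆ = cover-by-two (vars⊆ (here refl)) small
  in (c , D⊆ ∘ L⊆) , vars-twoPebble φ small (vars⊆ ∘ there) λ where
       (here refl)  → vars⊆ (here refl)
       (there x∈L) → L⊆ x∈L

nvars-twoPebble : ∀ φ → nvars φ ≤ 2 → TwoPebble [] φ
nvars-twoPebble φ small = vars-twoPebble φ small (∈-deduplicate⁺ _≟_) λ ()

-- Extension axioms

Extension : (G : Graph) → Subset (n G) → Subset (n G) → Set
Extension G X Y = Σ (Fin (n G)) λ z → z ∉ₛ X ∪ Y ×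
  (∀ x → x ∈ₛ X → adj G z x ≡ true) × (∀ y → y ∈ₛ Y → adj G z y ≡ false)

∣p∪q∣≤∣p∣+∣q∣ : ∀ {k} (p q : Subset k) → ∣ p ∪ q ∣ ≤ ∣ p ∣ + ∣ q ∣
∣p∪q∣≤∣p∣+∣q∣ [] [] = z≤n
∣p∪q∣≤∣p∣+∣q∣ (true ∷ p) (s ∷ q) =
  s≤s (≤-trans (∣p∪q∣≤∣p∣+∣q∣ p q) (+-monoʳ-≤ ∣ p ∣ (∣p∣≤∣x∷p∣ s q)))
∣p∪q∣≤∣p∣+∣q∣ (false ∷ p) (true ∷ q) rewrite +-suc ∣ p ∣ ∣ q ∣ = s≤s (∣p∪q∣≤∣p∣+∣q∣ p q)
∣p∪q∣≤∣p∣+∣q∣ (false ∷ p) (false ∷ q) = ∣p∪q∣≤∣p∣+∣q∣ p q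

∣⁅x⁆∣≤1 : ∀ {k} (x : Fin k) → ∣ ⁅ x ⁆ ∣ ≤ 1
∣⁅x⁆∣≤1 x = ≤-reflexive (∣⁅x⁆∣≡1 x)

∣∅∣≤0 : ∀ k → ∣ ∅ {k} ∣ ≤ 0
∣∅∣≤0 k = ≤-reflexive (∣⊥∣≡0 k)

∈⇒1≤∣p∣ : ∀ {k} {p : Subset k} {x} → x ∈ₛ p → 1 ≤ ∣ p ∣
∈⇒1≤∣p∣ x∈p = ≤-trans (s≤s z≤n) (x∈p⇒∣p-x∣<∣p∣ x∈p)

∣p∣≤1⇒members-equal : ∀ {k} {p : Subset k} {u w} → ∣ p ∣ ≤ 1 → u ∈ₛ p → w ∈ₛ p → w ≡ u
∣p∣≤1⇒members-equal {u = u} {w} small u∈p w∈p with w ≟ᶠ u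
... | yes w≡u = w≡u
... | no w≢u = contradiction two≤one λ { (s≤s ()) }
  where
  two≤one : 2 ≤ 1
  two≤one = ≤-trans (s≤s (∈⇒1≤∣p∣ (x∈p∧x≢y⇒x∈p-y w∈p w≢u))) (≤-trans (x∈p⇒∣p-x∣<∣p∣ u∈p) small)

module _ {G : Graph} (ea : EA 3 G) where

  EA₃-extension : ∀ X Y → Disjoint X Y → ∣ X ∣ + ∣ Y ∣ ≤ 2 → Extension G X Y
  EA₃-extension X Y disjoint size = ea X Y disjoint (s≤s (≤-trans (∣p∪q∣≤∣p∣+∣q∣ X Y) size))

  EA₃⇒commonNeighbour : ∀ u w → ∃[ z ] adj G z u ≡ true × adj G z w ≡ true
  EA₃⇒commonNeighbour u w =
    let z , _ , z~X , _ = EA₃-extension (⁅ u ⁆ ∪ ⁅ w ⁆) ∅ (λ _ _ → ∉⊥) size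
    in z , z~X u (x∈p∪q⁺ (inj₁ (x∈⁅x⁆ u))) , z~X w (x∈p∪q⁺ (inj₂ (x∈⁅x⁆ w)))
    where
    size : ∣ ⁅ u ⁆ ∪ ⁅ w ⁆ ∣ + ∣ ∅ {n G} ∣ ≤ 2
    size = +-mono-≤ (≤-trans (∣p∪q∣≤∣p∣+∣q∣ ⁅ u ⁆ ⁅ w ⁆) (+-mono-≤ (∣⁅x⁆∣≤1 u) (∣⁅x⁆∣≤1 w)))
                    (∣∅∣≤0 (n G))

  EA₃⇒separating : ∀ u w → u ≢ w → ∃[ z ] adj G z u ≡ true × adj G z w ≡ false
  EA₃⇒separating u w u≢w =
    let z , _ , z~X , z≁Y = EA₃-extension ⁅ u ⁆ ⁅ w ⁆ disjoint (+-mono-≤ (∣⁅x⁆∣≤1 u) (∣⁅x⁆∣≤1 w))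
    in z , z~X u (x∈⁅x⁆ u) , z≁Y w (x∈⁅x⁆ w)
    where
    disjoint : Disjoint ⁅ u ⁆ ⁅ w ⁆
    disjoint v v∈u v∈w = u≢w (trans (sym (x∈⁅y⁆⇒x≡y u v∈u)) (x∈⁅y⁆⇒x≡y w v∈w))

  EA₃⇒nonNeighbour : ∀ u → ∃[ z ] z ≢ u × adj G z u ≡ false
  EA₃⇒nonNeighbour u =
    let z , z∉ , _ , z≁Y = EA₃-extension ∅ ⁅ u ⁆ (λ _ v∈∅ → contradiction v∈∅ ∉⊥) size
    in z , (λ z≡u → z∉ (x∈p∪q⁺ (inj₂ (subst (_∈ₛ ⁅ u ⁆) (sym z≡u) (x∈⁅x⁆ u))))) , z≁Y u (x∈⁅x⁆ u)
    where
    size : ∣ ∅ {n G} ∣ + ∣ ⁅ u ⁆ ∣ ≤ 2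
    size = ≤-trans (+-mono-≤ (∣∅∣≤0 (n G)) (∣⁅x⁆∣≤1 u)) (s≤s z≤n)

  EA₃⇒TwoExtendable : TwoExtendable G
  EA₃⇒TwoExtendable = record
    { vertex = proj₁ (EA₃-extension ∅ ∅ (λ _ _ → ∉⊥) size)
    ; neighbour = λ u → let z , z~u , _ = EA₃⇒commonNeighbour u u in z , z~u
    ; nonNeighbour = EA₃⇒nonNeighbour
    }
    where
    size : ∣ ∅ {n G} ∣ + ∣ ∅ {n G} ∣ ≤ 2
    size = ≤-trans (+-mono-≤ (∣∅∣≤0 (n G)) (∣∅∣≤0 (n G))) z≤n

  EA₃⇒PawPattern : PawPattern G
  EA₃⇒PawPattern =
    let open TwoExtendable EA₃⇒TwoExtendable
        x = vertex
        a , a~x = neighbour x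
        b , b~x , b~a = EA₃⇒commonNeighbour x a
        y , y≢x , y≁x = nonNeighbour x
        c , c~x , c~y = EA₃⇒commonNeighbour x y
        p , p~x , p≁y = EA₃⇒separating x y (≢-sym y≢x)
    in record { x = x ; a = a ; b = b ; y = y ; c = c ; p = p
              ; a~x = a~x ; b~x = b~x ; b~a = b~a ; y≁x = y≁x
              ; c~x = c~x ; c~y = c~y ; p~x = p~x ; p≁y = p≁y }

module _ {G : Graph} (extendable : TwoExtendable G) where
  open TwoExtendable extendable

  empty-extension : ∀ X Y → ¬ Nonempty (X ∪ Y) → Extension G X Y
  empty-extension X Y empty =
    vertex , (λ v∈ → empty (vertex , v∈)) ,
    (λ x x∈X → contradiction (x , x∈p∪q⁺ (inj₁ x∈X)) empty) ,
    (λ y y∈Y → contradiction (y , x∈p∪q⁺ (inj₂ y∈Y)) empty)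

  singleton-extension : ∀ X Y v → Disjoint X Y → (∀ {w} → w ∈ₛ X ∪ Y → w ≡ v) → v ∈ₛ X ⊎ v ∈ₛ Y →
    Extension G X Y
  singleton-extension X Y v disjoint only-v (inj₁ v∈X) =
    let u , u~v = neighbour v
    in u , adj⇒≢ G u~v ∘ only-v ,
       (λ x x∈X → subst (λ w → adj G u w ≡ true) (sym (only-v (x∈p∪q⁺ (inj₁ x∈X)))) u~v) ,
       (λ y y∈Y → contradiction (subst (_∈ₛ Y) (only-v (x∈p∪q⁺ (inj₂ y∈Y))) y∈Y) (disjoint v v∈X))
  singleton-extension X Y v disjoint only-v (inj₂ v∈Y) =
    let u , u≢v , u≁v = nonNeighbour v
    in u , u≢v ∘ only-v ,
       (λ x x∈X → contradiction v∈Y (disjoint v (subst (_∈ₛ X) (only-v (x∈p∪q⁺ (inj₁ x∈X))) x∈X))) ,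
       (λ y y∈Y → subst (λ w → adj G u w ≡ false) (sym (only-v (x∈p∪q⁺ (inj₂ y∈Y)))) u≁v)

  TwoExtendable⇒EA₂ : EA 2 G
  TwoExtendable⇒EA₂ X Y disjoint size with nonempty? (X ∪ Y)
  ... | no empty = empty-extension X Y empty
  ... | yes (v , v∈X∪Y) =
    singleton-extension X Y v disjoint (∣p∣≤1⇒members-equal (s≤s⁻¹ size) v∈X∪Y) (x∈p∪q⁻ X Y v∈X∪Y)

theorem4p2 : D≡ paw 3 × W≡ paw 3 × W*≡ paw 3 × E≡ paw 3
theorem4p2 = D-paw , W-paw , W*-paw , E-paw
  where
  pawSentence-separates : ∀ G H → paw ⊏ G → ¬ paw ⊏ H → Distinguishes pawSentence G H
  pawSentence-separates = defines⇒distinguishes paw pawSentence pawSentence-defines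

  unseparated : ∀ φ → Distinguishes φ tadpole C₅ → ¬ TwoPebble [] φ
  unseparated φ = twoPebble-indistinguishable φ tadpole-twoExtendable C₅-twoExtendable

  undefinable : ∀ φ → Defines paw φ → ¬ TwoPebble [] φ
  undefinable φ defines =
    unseparated φ (defines⇒distinguishes paw φ defines tadpole C₅ paw⊏tadpole paw⊄C₅)

  D-paw : D≡ paw 3
  D-paw = (pawSentence , pawSentence-defines , refl) ,
    λ { _ (φ , defines , refl) → ≰⇒> λ qd≤2 → undefinable φ defines (qd-twoPebble φ qd≤2) }

  W-paw : W≡ paw 3
  W-paw = (pawSentence , pawSentence-defines , refl) ,
    λ { _ (φ , defines , refl) → ≰⇒> λ nvars≤2 → undefinable φ defines (nvars-twoPebble φ nvars≤2) }

  W-tadpole-C₅ : W₂≡ tadpole C₅ 3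
  W-tadpole-C₅ =
    (pawSentence , pawSentence-closed , pawSentence-separates tadpole C₅ paw⊏tadpole paw⊄C₅ , refl) ,
    λ { _ (φ , _ , separates , refl) →
          ≰⇒> λ nvars≤2 → unseparated φ separates (nvars-twoPebble φ nvars≤2) }

  W*-paw : W*≡ paw 3
  W*-paw = (tadpole , C₅ , paw⊏tadpole , paw⊄C₅ , W-tadpole-C₅) ,
    λ { _ (G , H , paw⊏G , paw⊄H , (_ , minimal)) →
          minimal 3 (pawSentence , pawSentence-closed ,
                     pawSentence-separates G H paw⊏G paw⊄H , refl) }

  E-paw : E≡ paw 3
  E-paw = (s≤s z≤n , λ G → PawPattern⇒paw⊏ ∘ EA₃⇒PawPattern {G}) , λ where
    1 (_ , forces) → contradiction (forces C₅ (# 0)) paw⊄C₅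
    2 (_ , forces) → contradiction (forces C₅ (TwoExtendable⇒EA₂ C₅-twoExtendable)) paw⊄C₅
    (suc (suc (suc _))) _ → s≤s (s≤s (s≤s z≤n))
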